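{- Let $T_v$ be a colored rooted ternary tree with root $v$ and exactly $5$ vertices, such that $v$ has two children, neither of which is a leaf. Let $\mathbf{v}$ be its root vector. Then there are $e_0,e_1,e_2,e_3\in\mathbb{N}$ such that $\mathbf{v}\geq\mathbf{e}=(\varphi^{e_0},\varphi^{e_1},\varphi^{e_2},\varphi^{e_3})$ and $\Psi(\mathbf{e})\geq 8$.
   Context: $\varphi=(1+\sqrt5)/2$, $\mathbb{N}=\{0,1,2,\dots\}$, $\Psi(\mathbf{e})=2(e_1+e_2+e_3)$, and $\geq$ between vectors is componentwise. A colored rooted ternary tree is a rooted tree in which every vertex has at most three children, every non-root vertex $x$ has a label $l_x\in\{1,2,3\}$, and children of a common vertex have distinct labels. Its root vector is defined recursively; for a vertex $x$ let $\mathbf{x}=(x_0,x_1,x_2,x_3)$ denote the root vector of the subtree of $x$ and its descendants. For the root $v$: Rule 0: no children gives $\mathbf{v}=(1,1,1,1)$. Rule 1: exactly one child $a$ gives $\mathbf{v}=(a_1,a_0+a_1,a_3,a_2)$, $(a_1,a_3,a_2,a_0+a_1)$ or $(a_1,a_2,a_0+a_1,a_3)$ according as $l_a=1,2,3$. Rule 2: for exactly two children named $a,b$ with $(l_a,l_b)\in\{(1,2),(2,3),(3,1)\}$: $\mathbf{v}=(a_1b_1,a_0b_2+a_1b_3,a_3b_2,a_2b_1+a_3b_0)$ if $l_a=1$; $(a_1b_1,a_3b_2,a_3b_0+a_2b_1,a_1b_3+a_0b_2)$ if $l_a=2$; $(a_1b_1,a_3b_0+a_2b_1,a_0b_2+a_1b_3,a_3b_2)$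 if $l_a=3$. Rule 3: three children $a,b,c$ labeled $1,2,3$ give $\mathbf{v}=(a_0b_0c_0+a_1b_1c_1,a_0b_2c_3+a_1b_3c_2,a_2b_3c_0+a_3b_2c_1,a_2b_1c_3+a_3b_0c_2)$. -}

module Defs where

open import Data.Nat as N using (ℕ; zero; suc)
open import Data.Integer as Z using (ℤ; +_; 0ℤ)
open import Data.Maybe using (Maybe; just; nothing)
open import Data.List using (List; []; _∷_)
open import Data.Product using (_×_; _,_)
open import Data.Sum using (_⊎_)
open import Relation.Binary.PropositionalEquality using (_≡_)

-- A vertex has (optionally) one child with each label 1, 2, 3; this
-- encodes "at most three children, children of a common vertex have
-- distinct labels".  The slot a child sits in is its label.

data Tree : Set where
  node : (c₁ c₂ c₃ : Maybe Tree) → Tree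

children : Tree → List Tree
children (node c₁ c₂ c₃) = cons c₁ (cons c₂ (cons c₃ []))
  where
  cons : Maybe Tree → List Tree → List Tree
  cons nothing  xs = xs
  cons (just t) xs = t ∷ xs

IsLeaf : Tree → Set
IsLeaf t = children t ≡ []

mutual
  size : Tree → ℕ
  size (node c₁ c₂ c₃) = suc (sizeM c₁ N.+ sizeM c₂ N.+ sizeM c₃)

  sizeM : Maybe Tree → ℕ
  sizeM nothing  = 0
  sizeM (just t) = size t

record V4 : Set where
  constructor ⟨_,_,_,_⟩
  field
    x₀ x₁ x₂ x₃ : ℕ
open V4 public

open N using (_+_; _*_)

rootVec : Tree → V4
rootVec (node nothing nothing nothing) = ⟨ 1 , 1 , 1 , 1 ⟩
rootVec (node (just a) nothing nothing) with rootVec a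
... | ⟨ a0 , a1 , a2 , a3 ⟩ = ⟨ a1 , a0 + a1 , a3 , a2 ⟩
rootVec (node nothing (just a) nothing) with rootVec a
... | ⟨ a0 , a1 , a2 , a3 ⟩ = ⟨ a1 , a3 , a2 , a0 + a1 ⟩
rootVec (node nothing nothing (just a)) with rootVec a
... | ⟨ a0 , a1 , a2 , a3 ⟩ = ⟨ a1 , a2 , a0 + a1 , a3 ⟩
rootVec (node (just a) (just b) nothing) with rootVec a | rootVec b
... | ⟨ a0 , a1 , a2 , a3 ⟩ | ⟨ b0 , b1 , b2 , b3 ⟩ =
  ⟨ a1 * b1 , a0 * b2 + a1 * b3 , a3 * b2 , a2 * b1 + a3 * b0 ⟩
rootVec (node nothing (just a) (just b)) with rootVec a | rootVec b
... | ⟨ a0 , a1 , a2 , a3 ⟩ | ⟨ b0 , b1 , b2 , b3 ⟩ =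
  ⟨ a1 * b1 , a3 * b2 , a3 * b0 + a2 * b1 , a1 * b3 + a0 * b2 ⟩
rootVec (node (just b) nothing (just a)) with rootVec a | rootVec b
... | ⟨ a0 , a1 , a2 , a3 ⟩ | ⟨ b0 , b1 , b2 , b3 ⟩ =
  ⟨ a1 * b1 , a3 * b0 + a2 * b1 , a0 * b2 + a1 * b3 , a3 * b2 ⟩
rootVec (node (just a) (just b) (just c)) with rootVec a | rootVec b | rootVec c
... | ⟨ a0 , a1 , a2 , a3 ⟩ | ⟨ b0 , b1 , b2 , b3 ⟩ | ⟨ c0 , c1 , c2 , c3 ⟩ =
  ⟨ a0 * b0 * c0 + a1 * b1 * c1
  , a0 * b2 * c3 + a1 * b3 * c2
  , a2 * b3 * c0 + a3 * b2 * c1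
  , a2 * b1 * c3 + a3 * b0 * c2 ⟩

-- The ring ℤ[φ] ⊂ ℝ, φ = (1+√5)/2, with the order inherited from ℝ.
-- An element ⟪ a , b ⟫ denotes the real number a + bφ.

record Zφ : Set where
  constructor ⟪_,_⟫
  field
    re : ℤ
    im : ℤ

_*φ_ : Zφ → Zφ → Zφ
⟪ a , b ⟫ *φ ⟪ c , d ⟫ = ⟪ a Z.* c Z.+ b Z.* d , a Z.* d Z.+ b Z.* c Z.+ b Z.* d ⟫
  -- uses φ² = φ + 1

φ : Zφ
φ = ⟪ + 0 , + 1 ⟫

oneφ : Zφ
oneφ = ⟪ + 1 , + 0 ⟫

_^φ_ : Zφ → ℕ → Zφ
x ^φ zero  = oneφ
x ^φ suc n = x *φ (x ^φ n)

fromℕ : ℕ → Zφ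
fromℕ n = ⟪ + n , + 0 ⟫

_-φ_ : Zφ → Zφ → Zφ
⟪ a , b ⟫ -φ ⟪ c , d ⟫ = ⟪ a Z.- c , b Z.- d ⟫

-- a + bφ ≥ 0  ⇔  p + q√5 ≥ 0  where p = 2a + b, q = b  (exact real sign test)
NonNeg : Zφ → Set
NonNeg ⟪ a , b ⟫ =
    (0ℤ Z.≤ p × 0ℤ Z.≤ q)
  ⊎ (0ℤ Z.≤ p × q Z.< 0ℤ × + 5 Z.* (q Z.* q) Z.≤ p Z.* p)
  ⊎ (p Z.< 0ℤ × 0ℤ Z.< q × p Z.* p Z.≤ + 5 Z.* (q Z.* q))
  where
  p = + 2 Z.* a Z.+ b
  q = b

_≤φ_ : Zφ → Zφ → Set
x ≤φ y = NonNeg (y -φ x)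

_≥φ-pow_ : V4 → V4 → Set
v ≥φ-pow e =
    (φ ^φ x₀ e) ≤φ fromℕ (x₀ v)
  × (φ ^φ x₁ e) ≤φ fromℕ (x₁ v)
  × (φ ^φ x₂ e) ≤φ fromℕ (x₂ v)
  × (φ ^φ x₃ e) ≤φ fromℕ (x₃ v)

-- Ψ(e) = 2(e₁ + e₂ + e₃)  (in terms of the exponent vector)
Ψ : V4 → ℕ
Ψ e = 2 * (x₁ e + x₂ e + x₃ e)

-- The hypotheses force the root to have two children a, b (labels 1-2, 2-3
-- or 3-1), each of which has a single leaf child: 27 colored trees in all.
-- Their root vectors have entries in {1, …, 5}; taking eᵢ = ⌊log_φ vᵢ⌋
-- (so φ^eᵢ ≤ vᵢ, using φ ≤ 2 and φ² ≤ 3 < 4 < φ³ ≤ 5) gives Ψ(e) ≥ 8 in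
-- every one of the 27 cases.
module Submission where

open import Defs
open import Data.Nat using (ℕ; suc; _+_; _*_; _≤_; _≥_; _≤ᵇ_; s≤s; z≤n; NonZero)
open import Data.Nat.Properties
  using (≤-antisym; ≤-trans; ≤-reflexive; +-cancelʳ-≤; +-cancelˡ-≤; +-monoʳ-≤; +-monoˡ-≤;
         +-assoc; +-identityʳ; suc-injective; m+n≡0⇒m≡0; m+n≡0⇒n≡0; ≤ᵇ⇒≤)
import Data.Integer as ℤ
open import Data.Integer using (0ℤ)
open import Data.Integer.Properties using (_≤?_; _<?_; pos-+; pos-*)
open import Data.Bool using (T)
open import Data.List using (length)
open import Data.List.Relation.Unary.All using (All; []; _∷_)
open import Data.Maybe using (just; nothing)
open import Data.Product using (Σ; ∃; _×_; _,_)
open import Data.Sum using (inj₁)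
open import Relation.Binary.PropositionalEquality using (_≡_; refl; sym; trans; cong; subst)
open import Relation.Nullary using (¬_; Dec)
open import Relation.Nullary.Decidable using (_×-dec_; _⊎-dec_; toWitness)

+-tight : ∀ {k l m n} → k ≤ m → l ≤ n → m + n ≡ k + l → m ≡ k × n ≡ l
+-tight {k} {l} {m} {n} k≤m l≤n eq =
  ≤-antisym (+-cancelʳ-≤ n m k (≤-trans (≤-reflexive eq) (+-monoʳ-≤ k l≤n))) k≤m ,
  ≤-antisym (+-cancelˡ-≤ m n l (≤-trans (≤-reflexive eq) (+-monoˡ-≤ l k≤m))) l≤n

data Label : Set where
  l₁ l₂ l₃ : Label

leaf : Tree
leaf = node nothing nothing nothing

stem : Label → Tree
stem l₁ = node (just leaf) nothing nothing
stem l₂ = node nothing (just leaf) nothing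
stem l₃ = node nothing nothing (just leaf)

fork : Label → Tree → Tree → Tree
fork l₁ s t = node (just s) (just t) nothing
fork l₂ s t = node nothing (just s) (just t)
fork l₃ s t = node (just t) nothing (just s)

2≤size : ∀ t → ¬ IsLeaf t → 2 ≤ size t
2≤size (node nothing nothing nothing) nonLeaf with () ← nonLeaf refl
2≤size (node (just (node _ _ _)) _ _) _ = s≤s (s≤s z≤n)
2≤size (node nothing (just (node _ _ _)) _) _ = s≤s (s≤s z≤n)
2≤size (node nothing nothing (just (node _ _ _))) _ = s≤s (s≤s z≤n)

size+n≡1⇒leaf : ∀ t {n} → size t + n ≡ 1 → t ≡ leaf × n ≡ 0
size+n≡1⇒leaf (node nothing nothing nothing) refl = refl , refl
size+n≡1⇒leaf (node (just (node _ _ _)) _ _) ()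
size+n≡1⇒leaf (node nothing (just (node _ _ _)) _) ()
size+n≡1⇒leaf (node nothing nothing (just (node _ _ _))) ()

sizeM≡0⇒nothing : ∀ c → sizeM c ≡ 0 → c ≡ nothing
sizeM≡0⇒nothing nothing _ = refl
sizeM≡0⇒nothing (just (node _ _ _)) ()

size≡2⇒stem : ∀ t → size t ≡ 2 → ∃ λ l → t ≡ stem l
size≡2⇒stem (node (just a) c₂ c₃) eq
  with size+n≡1⇒leaf a (trans (sym (+-assoc (size a) _ _)) (suc-injective eq))
... | refl , rest
  with refl ← sizeM≡0⇒nothing c₂ (m+n≡0⇒m≡0 _ rest)
     | refl ← sizeM≡0⇒nothing c₃ (m+n≡0⇒n≡0 (sizeM c₂) rest)
     = l₁ , refl
size≡2⇒stem (node nothing (just a) c₃) eq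
  with refl , rest ← size+n≡1⇒leaf a (suc-injective eq)
  with refl ← sizeM≡0⇒nothing c₃ rest
     = l₂ , refl
size≡2⇒stem (node nothing nothing (just a)) eq
  with refl , _ ← size+n≡1⇒leaf a (trans (+-identityʳ (size a)) (suc-injective eq))
     = l₃ , refl

nonLeaves⇒stems : ∀ s t → ¬ IsLeaf s → ¬ IsLeaf t → size s + size t ≡ 4
                → ∃ λ i → ∃ λ j → s ≡ stem i × t ≡ stem j
nonLeaves⇒stems s t nonLeaf-s nonLeaf-t eq
  with s≡2 , t≡2 ← +-tight (2≤size s nonLeaf-s) (2≤size t nonLeaf-t) eq
  with i , refl ← size≡2⇒stem s s≡2
     | j , refl ← size≡2⇒stem t t≡2
     = i , j , refl , refl

forkOfStems : ∀ t → size t ≡ 5 → length (children t) ≡ 2 → All (λ c → ¬ IsLeaf c) (children t)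
            → ∃ λ l → ∃ λ i → ∃ λ j → t ≡ fork l (stem i) (stem j)
forkOfStems (node (just a) (just b) nothing) eq _ (nonLeaf-a ∷ nonLeaf-b ∷ [])
  with i , j , refl , refl ←
         nonLeaves⇒stems a b nonLeaf-a nonLeaf-b (trans (sym (+-identityʳ _)) (suc-injective eq))
     = l₁ , i , j , refl
forkOfStems (node nothing (just a) (just b)) eq _ (nonLeaf-a ∷ nonLeaf-b ∷ [])
  with i , j , refl , refl ← nonLeaves⇒stems a b nonLeaf-a nonLeaf-b (suc-injective eq)
     = l₂ , i , j , refl
forkOfStems (node (just b) nothing (just a)) eq _ (nonLeaf-b ∷ nonLeaf-a ∷ [])
  with j , i , refl , refl ←
         nonLeaves⇒stems b a nonLeaf-b nonLeaf-a
           (trans (cong (_+ size a) (sym (+-identityʳ _))) (suc-injective eq))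
     = l₃ , i , j , refl
forkOfStems (node nothing nothing nothing) _ () _
forkOfStems (node (just _) nothing nothing) _ () _
forkOfStems (node nothing (just _) nothing) _ () _
forkOfStems (node nothing nothing (just _)) _ () _
forkOfStems (node (just _) (just _) (just _)) _ () _

nonNeg? : ∀ x → Dec (NonNeg x)
nonNeg? ⟪ a , b ⟫ =
  (0ℤ ≤? p ×-dec 0ℤ ≤? b)
  ⊎-dec (0ℤ ≤? p ×-dec b <? 0ℤ ×-dec ℤ.+ 5 ℤ.* (b ℤ.* b) ≤? p ℤ.* p)
  ⊎-dec (p <? 0ℤ ×-dec 0ℤ <? b ×-dec p ℤ.* p ≤? ℤ.+ 5 ℤ.* (b ℤ.* b))
  where
  p = ℤ.+ 2 ℤ.* a ℤ.+ b

_≤φ?_ : ∀ x y → Dec (x ≤φ y)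
x ≤φ? y = nonNeg? (y -φ x)

1≤φfromℕ : ∀ n → oneφ ≤φ fromℕ (suc n)
1≤φfromℕ n = inj₁ (subst (0ℤ ℤ.≤_) +2n≡p (ℤ.+≤+ z≤n) , ℤ.+≤+ z≤n)
  where
  +2n≡p : ℤ.+ (2 * n + 0) ≡ ℤ.+ 2 ℤ.* ℤ.+ n ℤ.+ ℤ.+ 0
  +2n≡p = trans (pos-+ (2 * n) 0) (cong (ℤ._+ ℤ.+ 0) (pos-* 2 n))

-- ⌊log_φ n⌋ for 1 ≤ n ≤ 5; the junk value 0 beyond is still a valid lower exponent.
logφ : ℕ → ℕ
logφ 2 = 1
logφ 3 = 2
logφ 4 = 2
logφ 5 = 3
logφ _ = 0

φ^logφ≤ : ∀ n → .{{NonZero n}} → (φ ^φ logφ n) ≤φ fromℕ n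
φ^logφ≤ 1 = 1≤φfromℕ 0
φ^logφ≤ 2 = toWitness {a? = (φ ^φ 1) ≤φ? fromℕ 2} _
φ^logφ≤ 3 = toWitness {a? = (φ ^φ 2) ≤φ? fromℕ 3} _
φ^logφ≤ 4 = toWitness {a? = (φ ^φ 2) ≤φ? fromℕ 4} _
φ^logφ≤ 5 = toWitness {a? = (φ ^φ 3) ≤φ? fromℕ 5} _
φ^logφ≤ (suc n@(suc (suc (suc (suc (suc _)))))) = 1≤φfromℕ n

HasPowerBound : V4 → Set
HasPowerBound v = Σ V4 (λ e → (v ≥φ-pow e) × (Ψ e ≥ 8))

logφ⁴ : V4 → V4
logφ⁴ ⟨ a , b , c , d ⟩ = ⟨ logφ a , logφ b , logφ c , logφ d ⟩

Positive : V4 → Set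
Positive v = NonZero (x₀ v) × NonZero (x₁ v) × NonZero (x₂ v) × NonZero (x₃ v)

logφ⁴-bound : ∀ v → Positive v → T (8 ≤ᵇ Ψ (logφ⁴ v)) → HasPowerBound v
logφ⁴-bound v@(⟨ a , b , c , d ⟩) (a≢0 , b≢0 , c≢0 , d≢0) Ψ≥8 =
  logφ⁴ v ,
  (φ^logφ≤ a {{a≢0}} , φ^logφ≤ b {{b≢0}} , φ^logφ≤ c {{c≢0}} , φ^logφ≤ d {{d≢0}}) ,
  ≤ᵇ⇒≤ 8 _ Ψ≥8

forkOfStems-hasPowerBound : ∀ l i j → HasPowerBound (rootVec (fork l (stem i) (stem j)))
forkOfStems-hasPowerBound l₁ l₁ l₁ = logφ⁴-bound _ _ _
forkOfStems-hasPowerBound l₁ l₁ l₂ = logφ⁴-bound _ _ _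
forkOfStems-hasPowerBound l₁ l₁ l₃ = logφ⁴-bound _ _ _
forkOfStems-hasPowerBound l₁ l₂ l₁ = logφ⁴-bound _ _ _
forkOfStems-hasPowerBound l₁ l₂ l₂ = logφ⁴-bound _ _ _
forkOfStems-hasPowerBound l₁ l₂ l₃ = logφ⁴-bound _ _ _
forkOfStems-hasPowerBound l₁ l₃ l₁ = logφ⁴-bound _ _ _
forkOfStems-hasPowerBound l₁ l₃ l₂ = logφ⁴-bound _ _ _
forkOfStems-hasPowerBound l₁ l₃ l₃ = logφ⁴-bound _ _ _
forkOfStems-hasPowerBound l₂ l₁ l₁ = logφ⁴-bound _ _ _
forkOfStems-hasPowerBound l₂ l₁ l₂ = logφ⁴-bound _ _ _
forkOfStems-hasPowerBound l₂ l₁ l₃ = logφ⁴-bound _ _ _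
forkOfStems-hasPowerBound l₂ l₂ l₁ = logφ⁴-bound _ _ _
forkOfStems-hasPowerBound l₂ l₂ l₂ = logφ⁴-bound _ _ _
forkOfStems-hasPowerBound l₂ l₂ l₃ = logφ⁴-bound _ _ _
forkOfStems-hasPowerBound l₂ l₃ l₁ = logφ⁴-bound _ _ _
forkOfStems-hasPowerBound l₂ l₃ l₂ = logφ⁴-bound _ _ _
forkOfStems-hasPowerBound l₂ l₃ l₃ = logφ⁴-bound _ _ _
forkOfStems-hasPowerBound l₃ l₁ l₁ = logφ⁴-bound _ _ _
forkOfStems-hasPowerBound l₃ l₁ l₂ = logφ⁴-bound _ _ _
forkOfStems-hasPowerBound l₃ l₁ l₃ = logφ⁴-bound _ _ _
forkOfStems-hasPowerBound l₃ l₂ l₁ = logφ⁴-bound _ _ _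
forkOfStems-hasPowerBound l₃ l₂ l₂ = logφ⁴-bound _ _ _
forkOfStems-hasPowerBound l₃ l₂ l₃ = logφ⁴-bound _ _ _
forkOfStems-hasPowerBound l₃ l₃ l₁ = logφ⁴-bound _ _ _
forkOfStems-hasPowerBound l₃ l₃ l₂ = logφ⁴-bound _ _ _
forkOfStems-hasPowerBound l₃ l₃ l₃ = logφ⁴-bound _ _ _

proposition15 : (t : Tree) → size t ≡ 5 → length (children t) ≡ 2
    → All (λ c → ¬ IsLeaf c) (children t)
    → Σ V4 (λ e → (rootVec t ≥φ-pow e) × (Ψ e ≥ 8))
proposition15 t size≡5 twoChildren nonLeaves
  with l , i , j , refl ← forkOfStems t size≡5 twoChildren nonLeaves
     = forkOfStems-hasPowerBound l i j
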